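{- For every $\mu>1/8$ there exists $n_0$ such that for every $n\geq n_0$ there exist a Dirac graph $G$ on $n$ vertices and a $\mu n$-bounded colouring of $E(G)$ such that $G$ contains no rainbow Hamilton cycle.
   Context: A Dirac graph is a graph $G$ on $n$ vertices with minimum degree $\delta(G)\geq n/2$. An edge-colouring of $G$ is $k$-bounded if no colour appears on more than $k$ edges. A subgraph is rainbow if no two of its edges have the same colour.
   Formalization: The parameter μ ranges only over the rationals greater than 1/8. -}

module Defs where

open import Data.Bool using (Bool; true; false; _∧_; if_then_else_)
open import Data.Nat using (ℕ; zero; suc; _+_; _*_; _≤_; _<_; _≡ᵇ_; _<ᵇ_; s≤s)
import Data.Nat as ℕ
open import Data.Fin using (Fin; zero; suc; toℕ; fromℕ<)
open import Data.Integer using (+_)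
open import Data.Rational using (ℚ; _/_)
import Data.Rational as ℚ
open import Data.Fin.Permutation using (Permutation′; _⟨$⟩ʳ_)
open import Relation.Binary.PropositionalEquality using (_≡_; _≢_)
open import Relation.Nullary using (yes; no)

countFin : ∀ {n} → (Fin n → Bool) → ℕ
countFin {zero}  P = 0
countFin {suc n} P = (if P zero then 1 else 0) + countFin (λ i → P (suc i))

sumFin : ∀ {n} → (Fin n → ℕ) → ℕ
sumFin {zero}  f = 0
sumFin {suc n} f = f zero + sumFin (λ i → f (suc i))

record Graph (n : ℕ) : Set where
  field
    adj    : Fin n → Fin n → Bool
    sym    : ∀ i j → adj i j ≡ adj j i
    irrefl : ∀ i → adj i i ≡ false
open Graph public

degree : ∀ {n} → Graph n → Fin n → ℕ
degree G v = countFin (λ w → adj G v w)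

-- Dirac graph: minimum degree ≥ n/2, i.e. 2·deg(v) ≥ n for every vertex v
IsDirac : ∀ {n} → Graph n → Set
IsDirac {n} G = ∀ v → n ≤ 2 * degree G v

-- An edge-colouring of G with colours in ℕ: a symmetric function on pairs
-- (only its values on edges matter)
record EdgeColouring {n : ℕ} (G : Graph n) : Set where
  field
    col    : Fin n → Fin n → ℕ
    colSym : ∀ i j → col i j ≡ col j i
open EdgeColouring public

colourClassSize : ∀ {n} {G : Graph n} → EdgeColouring G → ℕ → ℕ
colourClassSize {n} {G} c a =
  sumFin (λ i → countFin (λ j →
    (toℕ i <ᵇ toℕ j) ∧ (adj G i j ∧ (col c i j ≡ᵇ a))))

Bounded : ∀ {n} {G : Graph n} → ℚ → EdgeColouring G → Set
Bounded k c = ∀ a → (+ colourClassSize c a) / 1 ℚ.≤ k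

next : ∀ {n} → Fin n → Fin n
next {suc m} i with toℕ i ℕ.<? m
... | yes p = fromℕ< (s≤s p)
... | no _  = zero

record HamiltonCycle {n : ℕ} (G : Graph n) : Set where
  field
    σ     : Permutation′ n
    edges : ∀ i → adj G (σ ⟨$⟩ʳ i) (σ ⟨$⟩ʳ next i) ≡ true
open HamiltonCycle public

Rainbow : ∀ {n} {G : Graph n} → EdgeColouring G → HamiltonCycle G → Set
Rainbow {n} c H = ∀ (i j : Fin n) → i ≢ j →
  col c (σ H ⟨$⟩ʳ i) (σ H ⟨$⟩ʳ next i) ≢ col c (σ H ⟨$⟩ʳ j) (σ H ⟨$⟩ʳ next j)

module Submission where

-- With r = D + 1, w = 2r, K = 4D + 1,
-- the vertices split into B = [0, b), independent and complete to A = [b, n), where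
-- n − 2b ∈ {K + 1, K + 2}; inside A two vertices are adjacent when one lies in the
-- other's window of w + 1 consecutive vertices, so every degree is ≥ n/2.  Edges
-- between A and B get distinct colours, an edge inside A the index of the block of
-- L ≈ |A|/K vertices containing its smaller end: only K colours occur inside A.
-- A Hamilton cycle has at most 2b edges meeting B, so more than K edges inside A,
-- two of one colour (the general counting lemma `few-colours⇒¬rainbow`).  A colour
-- class inside A consists of forward edges of one block, at most r per vertex except
-- for 3r + 1 exceptional vertices, hence ≤ r(L + 3r + 1) ≈ rn/(8D) ≤ μn edges.
-- The file develops counting over Fin n, then the no-rainbow lemma and the rational
-- bound, then the construction with its Dirac and colour-class properties, and
-- finally theorem4.

open import Defs hiding (sym)

import Algebra.Properties.CommutativeMonoid.Sum as MonoidSum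
open import Data.Bool using (Bool; true; false; _∧_; _∨_; not; if_then_else_; T)
open import Data.Bool.Properties using (∨-comm; ∧-zeroʳ)
open import Data.Empty using (⊥-elim)
open import Data.Fin as F using (Fin; zero; suc; toℕ)
import Data.Fin.Properties as FP
open import Data.Fin.Permutation using (Permutation′; _⟨$⟩ʳ_)
open import Data.Integer as ℤ using (-[1+_])
import Data.Integer.Properties as ℤP
open import Data.List using ([]; _∷_)
open import Data.Nat as ℕ using (ℕ; zero; suc; _+_; _*_; _∸_; _≤_; _<_; _≥_; z≤n; s≤s; _<ᵇ_; _≡ᵇ_; _⊓_; _⊔_; NonZero)
open import Data.Nat.Coprimality using (Coprime; 1-coprimeTo) renaming (sym to coprime-sym)
open import Data.Nat.Divisibility using (divides)
open import Data.Nat.DivMod using (_/_; _%_; m≡m%n+[m/n]*n; m%n<n; m/n*n≤m; m<n*o⇒m/o<n; +-distrib-/-∣ʳ; m<n⇒m/n≡0; m*n/n≡m)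
import Data.Nat.Properties as ℕP
open import Data.Nat.Tactic.RingSolver using (solve-∀; solve)
open import Data.Product using (Σ; ∃; _×_; _,_; proj₁; proj₂)
import Data.Rational as ℚ
open import Data.Rational using (ℚ; mkℚ; *<*)
import Data.Rational.Properties as ℚP
import Data.Rational.Unnormalised as ℚᵘ
import Data.Rational.Unnormalised.Properties as ℚᵘP
open import Data.Sum using (_⊎_; inj₁; inj₂)
open import Data.Unit using (tt)
open import Relation.Binary.PropositionalEquality using (_≡_; _≢_; refl; sym; trans; cong; cong₂; subst; subst₂; module ≡-Reasoning)
open import Relation.Nullary using (¬_; yes; no)

T⇒≡true : ∀ {a} → T a → a ≡ true
T⇒≡true {true} _ = refl

≡true⇒T : ∀ {a} → a ≡ true → T a
≡true⇒T refl = tt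

¬true⇒false : ∀ {a} → ¬ (a ≡ true) → a ≡ false
¬true⇒false {true} ¬t = ⊥-elim (¬t refl)
¬true⇒false {false} _ = refl

true≢false : true ≢ false
true≢false ()

true-or-false : ∀ a → (a ≡ true) ⊎ (a ≡ false)
true-or-false true = inj₁ refl
true-or-false false = inj₂ refl

<ᵇ-true⇒< : ∀ {m n} → (m <ᵇ n) ≡ true → m < n
<ᵇ-true⇒< {m} {n} e = ℕP.<ᵇ⇒< m n (≡true⇒T e)

<⇒<ᵇ-true : ∀ {m n} → m < n → (m <ᵇ n) ≡ true
<⇒<ᵇ-true p = T⇒≡true (ℕP.<⇒<ᵇ p)

<ᵇ-false⇒≥ : ∀ {m n} → (m <ᵇ n) ≡ false → n ≤ m
<ᵇ-false⇒≥ e = ℕP.≮⇒≥ λ m<n → true≢false (trans (sym (<⇒<ᵇ-true m<n)) e)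

≥⇒<ᵇ-false : ∀ {m n} → n ≤ m → (m <ᵇ n) ≡ false
≥⇒<ᵇ-false n≤m = ¬true⇒false λ e → ℕP.<⇒≱ (<ᵇ-true⇒< e) n≤m

≡ᵇ-true⇒≡ : ∀ {m n} → (m ≡ᵇ n) ≡ true → m ≡ n
≡ᵇ-true⇒≡ {m} {n} e = ℕP.≡ᵇ⇒≡ m n (≡true⇒T e)

≡⇒≡ᵇ-true : ∀ {m n} → m ≡ n → (m ≡ᵇ n) ≡ true
≡⇒≡ᵇ-true {m} {n} p = T⇒≡true (ℕP.≡⇒≡ᵇ m n p)

≢⇒≡ᵇ-false : ∀ {m n} → m ≢ n → (m ≡ᵇ n) ≡ false
≢⇒≡ᵇ-false m≢n = ¬true⇒false λ e → m≢n (≡ᵇ-true⇒≡ e)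

≡ᵇ-false⇒≢ : ∀ {m n} → (m ≡ᵇ n) ≡ false → m ≢ n
≡ᵇ-false⇒≢ e m≡n = true≢false (trans (sym (≡⇒≡ᵇ-true m≡n)) e)

≡ᵇ-comm : ∀ m n → (m ≡ᵇ n) ≡ (n ≡ᵇ m)
≡ᵇ-comm m n with true-or-false (m ≡ᵇ n)
... | inj₁ e = trans e (sym (≡⇒≡ᵇ-true (sym (≡ᵇ-true⇒≡ {m} e))))
... | inj₂ e = trans e (sym (≢⇒≡ᵇ-false {n} {m} λ n≡m → ≡ᵇ-false⇒≢ e (sym n≡m)))

∧-true-l : ∀ {a b} → (a ∧ b) ≡ true → a ≡ true
∧-true-l {true} _ = refl

∧-true-r : ∀ {a b} → (a ∧ b) ≡ true → b ≡ true
∧-true-r {true} e = e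

∧-true : ∀ {a b} → a ≡ true → b ≡ true → (a ∧ b) ≡ true
∧-true refl refl = refl

∨-true-elim : ∀ {a b} → (a ∨ b) ≡ true → (a ≡ true) ⊎ (b ≡ true)
∨-true-elim {true} _ = inj₁ refl
∨-true-elim {false} e = inj₂ e

∨-true-l : ∀ {a b} → a ≡ true → (a ∨ b) ≡ true
∨-true-l refl = refl

∨-true-r : ∀ {a b} → b ≡ true → (a ∨ b) ≡ true
∨-true-r {true} _ = refl
∨-true-r {false} e = e

∨-false : ∀ {a b} → (a ∨ b) ≡ false → (a ≡ false) × (b ≡ false)
∨-false {false} {false} _ = refl , refl

not-true⇒false : ∀ {a} → not a ≡ true → a ≡ false
not-true⇒false {false} _ = refl

false⇒not-true : ∀ {a} → a ≡ false → not a ≡ true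
false⇒not-true refl = refl

indicator : Bool → ℕ
indicator a = if a then 1 else 0

count-cong : ∀ {n} (P Q : Fin n → Bool) → (∀ i → P i ≡ Q i) → countFin P ≡ countFin Q
count-cong {zero} P Q h = refl
count-cong {suc n} P Q h = cong₂ _+_ (cong indicator (h zero)) (count-cong _ _ λ i → h (suc i))

count-mono : ∀ {n} (P Q : Fin n → Bool) → (∀ i → P i ≡ true → Q i ≡ true) → countFin P ≤ countFin Q
count-mono {zero} P Q h = z≤n
count-mono {suc n} P Q h with P zero in e1 | Q zero in e2
... | true | true = s≤s (count-mono _ _ λ i → h (suc i))
... | true | false with () ← trans (sym (h zero e1)) e2
... | false | true = ℕP.m≤n⇒m≤1+n (count-mono _ _ λ i → h (suc i))
... | false | false = count-mono _ _ λ i → h (suc i)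

count-∨ : ∀ {n} (P Q : Fin n → Bool) → countFin (λ i → P i ∨ Q i) ≤ countFin P + countFin Q
count-∨ {zero} P Q = z≤n
count-∨ {suc n} P Q with P zero | Q zero
... | true | true = s≤s (ℕP.≤-trans (count-∨ P′ Q′) (ℕP.+-monoʳ-≤ (countFin P′) (ℕP.n≤1+n _)))
  where P′ = λ i → P (suc i); Q′ = λ i → Q (suc i)
... | true | false = s≤s (count-∨ (λ i → P (suc i)) (λ i → Q (suc i)))
... | false | true = ℕP.≤-trans (s≤s (count-∨ (λ i → P (suc i)) (λ i → Q (suc i)))) (ℕP.≤-reflexive (sym (ℕP.+-suc _ _)))
... | false | false = count-∨ (λ i → P (suc i)) (λ i → Q (suc i))

count-disjoint-∨ : ∀ {n} (P Q : Fin n → Bool) → (∀ i → P i ≡ true → Q i ≡ false) →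
  countFin P + countFin Q ≤ countFin (λ i → P i ∨ Q i)
count-disjoint-∨ {zero} P Q h = z≤n
count-disjoint-∨ {suc n} P Q h with P zero in e1 | Q zero in e2
... | true | true with () ← trans (sym (h zero e1)) e2
... | true | false = s≤s (count-disjoint-∨ _ _ λ i → h (suc i))
... | false | true = ℕP.≤-trans (ℕP.≤-reflexive (ℕP.+-suc _ _)) (s≤s (count-disjoint-∨ _ _ λ i → h (suc i)))
... | false | false = count-disjoint-∨ _ _ λ i → h (suc i)

count-none : ∀ {n} (P : Fin n → Bool) → (∀ i → P i ≡ false) → countFin P ≡ 0
count-none {zero} P h = refl
count-none {suc n} P h rewrite h zero = count-none _ λ i → h (suc i)

count-all : ∀ n → countFin {n} (λ _ → true) ≡ n
count-all zero = refl
count-all (suc n) = cong suc (count-all n)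

count-unique : ∀ {n} (P : Fin n → Bool) → (∀ i j → P i ≡ true → P j ≡ true → i ≡ j) → countFin P ≤ 1
count-unique {zero} P h = z≤n
count-unique {suc n} P h with P zero in e
... | true = s≤s (ℕP.≤-reflexive (count-none _ λ i → ¬true⇒false λ e′ → 0≢suc (h zero (suc i) e e′)))
  where
  0≢suc : ∀ {i : Fin n} → zero ≢ suc i
  0≢suc ()
... | false = count-unique _ λ i j p q → FP.suc-injective (h (suc i) (suc j) p q)

count-interval-upper : ∀ {n} (P : Fin n → Bool) lo m →
  (∀ i → P i ≡ true → lo ≤ toℕ i × toℕ i < lo + m) → countFin P ≤ m
count-interval-upper {zero} P lo m h = z≤n
count-interval-upper {suc n} P (suc lo) m h with P zero in e
... | true with () ← proj₁ (h zero e)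
... | false = count-interval-upper _ lo m λ i p → let (l , u) = h (suc i) p in ℕP.≤-pred l , ℕP.≤-pred u
count-interval-upper {suc n} P zero m h with P zero in e
count-interval-upper {suc n} P zero zero h | true with () ← proj₂ (h zero e)
count-interval-upper {suc n} P zero (suc m) h | true =
  s≤s (count-interval-upper _ zero m λ i p → z≤n , ℕP.≤-pred (proj₂ (h (suc i) p)))
count-interval-upper {suc n} P zero m h | false =
  count-interval-upper _ zero m λ i p → z≤n , ℕP.≤-trans (ℕP.n≤1+n _) (proj₂ (h (suc i) p))

count-interval-lower : ∀ {n} (P : Fin n → Bool) lo m → lo + m ≤ n →
  (∀ i → lo ≤ toℕ i → toℕ i < lo + m → P i ≡ true) → m ≤ countFin P
count-interval-lower {n} P zero zero le h = z≤n
count-interval-lower {suc n} P zero (suc m) le h rewrite h zero z≤n (s≤s z≤n) =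
  s≤s (count-interval-lower _ zero m (ℕP.≤-pred le) λ i _ lt → h (suc i) z≤n (s≤s lt))
count-interval-lower {zero} P (suc lo) m () h
count-interval-lower {suc n} P (suc lo) m le h =
  ℕP.≤-trans (count-interval-lower _ lo m (ℕP.≤-pred le) λ i l u → h (suc i) (s≤s l) (s≤s u)) (ℕP.m≤n+m _ _)

count-injective : ∀ {n} (Z : Fin n → Bool) (f : Fin n → ℕ) K →
  (∀ i j → Z i ≡ true → Z j ≡ true → f i ≡ f j → i ≡ j) → (∀ i → Z i ≡ true → f i < K) →
  countFin Z ≤ K
count-injective Z f zero inj bound =
  ℕP.≤-reflexive (count-none Z λ i → ¬true⇒false λ e → ℕP.n≮0 (bound i e))
count-injective Z f (suc K) inj bound = begin
    countFin Z
  ≤⟨ count-mono Z (λ i → Below i ∨ AtK i) split ⟩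
    countFin (λ i → Below i ∨ AtK i)
  ≤⟨ count-∨ Below AtK ⟩
    countFin Below + countFin AtK
  ≤⟨ ℕP.+-mono-≤ below-K at-most-one ⟩
    K + 1
  ≡⟨ ℕP.+-comm K 1 ⟩
    suc K ∎
  where
  open ℕP.≤-Reasoning
  Below AtK : _ → Bool
  Below i = Z i ∧ (f i <ᵇ K)
  AtK i = Z i ∧ (f i ≡ᵇ K)
  split : ∀ i → Z i ≡ true → (Below i ∨ AtK i) ≡ true
  split i z with ℕP.m≤n⇒m<n∨m≡n (ℕP.≤-pred (bound i z))
  ... | inj₁ lt = ∨-true-l (∧-true z (<⇒<ᵇ-true lt))
  ... | inj₂ eq = ∨-true-r {Below i} (∧-true z (≡⇒≡ᵇ-true eq))
  below-K : countFin Below ≤ K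
  below-K = count-injective Below f K (λ i j p q → inj i j (∧-true-l p) (∧-true-l q))
    λ i p → <ᵇ-true⇒< (∧-true-r {Z i} p)
  at-most-one : countFin AtK ≤ 1
  at-most-one = count-unique AtK λ i j p q →
    inj i j (∧-true-l p) (∧-true-l q) (trans (≡ᵇ-true⇒≡ (∧-true-r {Z i} p)) (sym (≡ᵇ-true⇒≡ (∧-true-r {Z j} q))))

sum-mono : ∀ {n} (f g : Fin n → ℕ) → (∀ i → f i ≤ g i) → sumFin f ≤ sumFin g
sum-mono {zero} f g h = z≤n
sum-mono {suc n} f g h = ℕP.+-mono-≤ (h zero) (sum-mono _ _ λ i → h (suc i))

sum-+ : ∀ {n} (f g : Fin n → ℕ) → sumFin (λ i → f i + g i) ≡ sumFin f + sumFin g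
sum-+ {zero} f g = refl
sum-+ {suc n} f g rewrite sum-+ (λ i → f (suc i)) (λ i → g (suc i)) = interchange (f zero) (g zero) _ _
  where
  interchange : ∀ a b c d → (a + b) + (c + d) ≡ (a + c) + (b + d)
  interchange = solve-∀

sum-indicator : ∀ {n} (P : Fin n → Bool) → sumFin (λ i → indicator (P i)) ≡ countFin P
sum-indicator {zero} P = refl
sum-indicator {suc n} P = cong (indicator (P zero) +_) (sum-indicator (λ i → P (suc i)))

sum-scaled-indicator : ∀ {n} (k : ℕ) (P : Fin n → Bool) → sumFin (λ i → k * indicator (P i)) ≡ k * countFin P
sum-scaled-indicator {zero} k P = sym (ℕP.*-zeroʳ k)
sum-scaled-indicator {suc n} k P rewrite sum-scaled-indicator k (λ i → P (suc i)) =
  sym (ℕP.*-distribˡ-+ k (indicator (P zero)) _)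

module Sum = MonoidSum ℕP.+-0-commutativeMonoid

count≡sum : ∀ {n} (P : Fin n → Bool) → countFin P ≡ Sum.sum (λ i → indicator (P i))
count≡sum {zero} P = refl
count≡sum {suc n} P = cong (indicator (P zero) +_) (count≡sum (λ i → P (suc i)))

count-permute : ∀ {n} (P : Fin n → Bool) (π : Permutation′ n) → countFin (λ i → P (π ⟨$⟩ʳ i)) ≡ countFin P
count-permute P π = begin
    countFin (λ i → P (π ⟨$⟩ʳ i))
  ≡⟨ count≡sum (λ i → P (π ⟨$⟩ʳ i)) ⟩
    Sum.sum (λ i → indicator (P (π ⟨$⟩ʳ i)))
  ≡⟨ sym (Sum.sum-permute (λ i → indicator (P i)) π) ⟩
    Sum.sum (λ i → indicator (P i))
  ≡⟨ sym (count≡sum P) ⟩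
    countFin P ∎
  where open ≡-Reasoning

count-last : ∀ {m} (Q : Fin (suc m) → Bool) → countFin Q ≡ countFin (λ i → Q (F.inject₁ i)) + indicator (Q (F.fromℕ m))
count-last {zero} Q = ℕP.+-comm (indicator (Q zero)) 0
count-last {suc m} Q rewrite count-last (λ i → Q (suc i)) = sym (ℕP.+-assoc (indicator (Q zero)) _ _)

next-inject₁ : ∀ {m} (i : Fin m) → next {suc m} (F.inject₁ i) ≡ suc i
next-inject₁ {m} i with toℕ (F.inject₁ i) ℕ.<? m
... | yes p = FP.toℕ-injective (trans (FP.toℕ-fromℕ< (s≤s p)) (cong suc (FP.toℕ-inject₁ i)))
... | no ¬p = ⊥-elim (¬p (subst (_< m) (sym (FP.toℕ-inject₁ i)) (FP.toℕ<n i)))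

next-last : ∀ m → next {suc m} (F.fromℕ m) ≡ zero
next-last m with toℕ (F.fromℕ m) ℕ.<? m
... | yes p = ⊥-elim (ℕP.<-irrefl (FP.toℕ-fromℕ m) p)
... | no _ = refl

count-next : ∀ {n} (P : Fin n → Bool) → countFin (λ i → P (next i)) ≡ countFin P
count-next {zero} P = refl
count-next {suc m} P = begin
    countFin (λ i → P (next i))
  ≡⟨ count-last (λ i → P (next i)) ⟩
    countFin (λ i → P (next (F.inject₁ i))) + indicator (P (next (F.fromℕ m)))
  ≡⟨ cong₂ _+_ (count-cong _ _ λ i → cong P (next-inject₁ i)) (cong (λ v → indicator (P v)) (next-last m)) ⟩
    countFin (λ i → P (suc i)) + indicator (P zero)
  ≡⟨ ℕP.+-comm _ (indicator (P zero)) ⟩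
    countFin P ∎
  where open ≡-Reasoning

starts-ends-or-avoids : ∀ a b → (a ∨ (b ∨ (not a ∧ not b))) ≡ true
starts-ends-or-avoids true _ = refl
starts-ends-or-avoids false true = refl
starts-ends-or-avoids false false = refl

-- If the edges avoiding a vertex set S of size ≤ k use fewer than K colours and
-- n > 2k + K, then no Hamilton cycle is rainbow: at most 2k of its n edges meet
-- S, and the others carry distinct colours below K.
few-colours⇒¬rainbow : ∀ {n} {G : Graph n} (c : EdgeColouring G) (S : Fin n → Bool) (k K : ℕ) →
  countFin S ≤ k →
  (∀ i j → S i ≡ false → S j ≡ false → adj G i j ≡ true → col c i j < K) →
  2 * k + K < n →
  (H : HamiltonCycle G) → ¬ Rainbow c H
few-colours⇒¬rainbow {n} c S k K |S|≤k colour<K few H rainbow =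
  ℕP.<-irrefl refl (ℕP.<-≤-trans few n≤2k+K)
  where
  π : Permutation′ n
  π = σ H
  starts ends avoids : Fin n → Bool
  starts i = S (π ⟨$⟩ʳ i)
  ends i = S (π ⟨$⟩ʳ next i)
  avoids i = not (starts i) ∧ not (ends i)
  colour : Fin n → ℕ
  colour i = col c (π ⟨$⟩ʳ i) (π ⟨$⟩ʳ next i)

  |starts|≤k : countFin starts ≤ k
  |starts|≤k = ℕP.≤-trans (ℕP.≤-reflexive (count-permute S π)) |S|≤k
  |ends|≤k : countFin ends ≤ k
  |ends|≤k = ℕP.≤-trans (ℕP.≤-reflexive (count-next starts)) |starts|≤k

  -- the rainbow property makes `colour` injective, so the avoiding edges number ≤ K
  colour-injective : ∀ i j → avoids i ≡ true → avoids j ≡ true → colour i ≡ colour j → i ≡ j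
  colour-injective i j _ _ same with i F.≟ j
  ... | yes i≡j = i≡j
  ... | no i≢j = ⊥-elim (rainbow i j i≢j same)
  avoiding-colour<K : ∀ i → avoids i ≡ true → colour i < K
  avoiding-colour<K i e = colour<K _ _ (not-true⇒false (∧-true-l e)) (not-true⇒false (∧-true-r {not (starts i)} e)) (edges H i)
  |avoids|≤K : countFin avoids ≤ K
  |avoids|≤K = count-injective avoids colour K colour-injective avoiding-colour<K

  n≤2k+K : n ≤ 2 * k + K
  n≤2k+K = begin
      n
    ≡⟨ sym (count-all n) ⟩
      countFin {n} (λ _ → true)
    ≤⟨ count-mono _ (λ i → starts i ∨ (ends i ∨ avoids i)) (λ i _ → starts-ends-or-avoids (starts i) (ends i)) ⟩
      countFin (λ i → starts i ∨ (ends i ∨ avoids i))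
    ≤⟨ count-∨ starts (λ i → ends i ∨ avoids i) ⟩
      countFin starts + countFin (λ i → ends i ∨ avoids i)
    ≤⟨ ℕP.+-monoʳ-≤ (countFin starts) (count-∨ ends avoids) ⟩
      countFin starts + (countFin ends + countFin avoids)
    ≤⟨ ℕP.+-mono-≤ |starts|≤k (ℕP.+-mono-≤ |ends|≤k |avoids|≤K) ⟩
      k + (k + K)
    ≡⟨ solve (k ∷ K ∷ []) ⟩
      2 * k + K ∎
    where open ℕP.≤-Reasoning

n/1≡mkℚ : ∀ n → (ℤ.+ n) ℚ./ 1 ≡ mkℚ (ℤ.+ n) 0 (coprime-sym (1-coprimeTo n))
n/1≡mkℚ n = ℚP.normalize-coprime (coprime-sym (1-coprimeTo n))

≤-fraction-* : ∀ N d .(cop : Coprime N (suc d)) m x →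
  suc d * m ≤ N * x → (ℤ.+ m) ℚ./ 1 ℚ.≤ mkℚ (ℤ.+ N) d cop ℚ.* ((ℤ.+ x) ℚ./ 1)
≤-fraction-* N d cop m x h rewrite n/1≡mkℚ m | n/1≡mkℚ x =
  ℚP.toℚᵘ-cancel-≤ (ℚᵘP.≤-respʳ-≃ (ℚᵘP.≃-sym (ℚP.toℚᵘ-homo-* (mkℚ (ℤ.+ N) d cop) (mkℚ (ℤ.+ x) 0 (coprime-sym (1-coprimeTo x))))) (ℚᵘ.*≤* cross))
  where
  cross : ℤ.+ m ℤ.* ℤ.+ (suc d * 1) ℤ.≤ (ℤ.+ N ℤ.* ℤ.+ x) ℤ.* ℤ.+ 1
  cross rewrite sym (ℤP.pos-* N x) | sym (ℤP.pos-* m (suc d * 1)) | sym (ℤP.pos-* (N * x) 1)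
    | ℕP.*-identityʳ (suc d) | ℕP.*-identityʳ (N * x) | ℕP.*-comm m (suc d) = ℤ.+≤+ h

>1/8⇒denominator<8·numerator : ∀ N d .(cop : Coprime N (suc d)) →
  mkℚ (ℤ.+ N) d cop ℚ.> (ℤ.+ 1) ℚ./ 8 → suc (suc d) ≤ N * 8
>1/8⇒denominator<8·numerator N d cop (*<* p) = ℕP.≤-trans (ℕP.≤-reflexive (cong suc (sym (ℕP.*-identityˡ (suc d)))))
  (ℤP.drop‿+<+ (subst₂ ℤ._<_ (sym (ℤP.pos-* 1 (suc d))) (sym (ℤP.pos-* N 8)) p))

division-block : ∀ m L .{{_ : NonZero L}} → (m / L * L ≤ m) × (m < m / L * L + L)
division-block m L = m/n*n≤m m L , (begin-strict
    m
  ≡⟨ m≡m%n+[m/n]*n m L ⟩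
    m % L + m / L * L
  <⟨ ℕP.+-monoˡ-< (m / L * L) (m%n<n m L) ⟩
    L + m / L * L
  ≡⟨ ℕP.+-comm L _ ⟩
    m / L * L + L ∎)
  where open ℕP.≤-Reasoning

⊓≤-cases : ∀ m n p → m ⊓ n ≤ p → (m ≤ p) ⊎ (n ≤ p)
⊓≤-cases m n p h with ℕP.⊓-sel m n
... | inj₁ e = inj₁ (subst (_≤ p) e h)
... | inj₂ e = inj₂ (subst (_≤ p) e h)

shift-≤ : ∀ {b x y} k → b ≤ x → y ∸ b ≤ (x ∸ b) + k → y ≤ x + k
shift-≤ {b} {x} {y} k b≤x h = begin
    y
  ≤⟨ ℕP.m≤n+m∸n y b ⟩
    b + (y ∸ b)
  ≤⟨ ℕP.+-monoʳ-≤ b h ⟩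
    b + ((x ∸ b) + k)
  ≡⟨ sym (ℕP.+-assoc b (x ∸ b) k) ⟩
    (b + (x ∸ b)) + k
  ≡⟨ cong (_+ k) (ℕP.m+[n∸m]≡n b≤x) ⟩
    x + k ∎
  where open ℕP.≤-Reasoning

-- The numerical parameters for a target ratio N/D: forward degree r, degree w
-- inside A, number K of colours inside A, gap s ≤ n − 2|B|, the number E of
-- exceptional vertices, and the number of vertices from which colour classes
-- have at most (N/D)·n edges.
module Parameters (D : ℕ) where
  r w K s E threshold : ℕ
  r = suc D
  w = 2 * r
  K = suc (4 * D)
  s = suc K
  E = r + suc w
  threshold = 4 * D * suc s + 8 * D * K * (1 + E)

module Construction (D n : ℕ) (n-large : 4 * suc D + 2 ≤ n) where
  open Parameters D

  -- |B| = b = ⌊(n − s)/2⌋; kept opaque, only its defining equation is used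
  opaque
    b : ℕ
    b = (n ∸ s) / 2

    n∸s≡ : n ∸ s ≡ (n ∸ s) % 2 + b * 2
    n∸s≡ = m≡m%n+[m/n]*n (n ∸ s) 2

  -- |A| = a, and colour blocks of L consecutive vertices of A
  a L : ℕ
  a = n ∸ b
  L = suc (a / K)

  -- A is handled in positions p = x − b ∈ [0, a); the window of p is [lo p, lo p + w]
  lo : ℕ → ℕ
  lo p = (p ∸ r) ⊓ (a ∸ suc w)

  inWindow : ℕ → ℕ → Bool
  inWindow p q = not (q <ᵇ lo p) ∧ (q <ᵇ suc (lo p + w))

  adjA : ℕ → ℕ → Bool
  adjA p q = not (p ≡ᵇ q) ∧ (inWindow p q ∨ inWindow q p)

  adjN : ℕ → ℕ → Bool
  adjN x y = if x <ᵇ b then not (y <ᵇ b) else (if y <ᵇ b then true else adjA (x ∸ b) (y ∸ b))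

  -- colour of {x, y} for x ≤ y: distinct colours ≥ K between B and A, block colours inside A
  colN : ℕ → ℕ → ℕ
  colN x y = if y <ᵇ b then 0 else (if x <ᵇ b then K + (y + x * n) else (x ∸ b) / L)

  adjA-sym : ∀ p q → adjA p q ≡ adjA q p
  adjA-sym p q rewrite ≡ᵇ-comm p q | ∨-comm (inWindow p q) (inWindow q p) = refl

  adjN-sym : ∀ x y → adjN x y ≡ adjN y x
  adjN-sym x y with x <ᵇ b | y <ᵇ b
  ... | true | true = refl
  ... | true | false = refl
  ... | false | true = refl
  ... | false | false = adjA-sym (x ∸ b) (y ∸ b)

  adjN-irrefl : ∀ x → adjN x x ≡ false
  adjN-irrefl x with x <ᵇ b
  ... | true = refl
  ... | false rewrite ≡⇒≡ᵇ-true {x ∸ b} refl = refl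

  G : Graph n
  G = record
    { adj = λ i j → adjN (toℕ i) (toℕ j)
    ; sym = λ i j → adjN-sym (toℕ i) (toℕ j)
    ; irrefl = λ i → adjN-irrefl (toℕ i)
    }

  colF : Fin n → Fin n → ℕ
  colF i j = colN (toℕ i ⊓ toℕ j) (toℕ i ⊔ toℕ j)

  colouring : EdgeColouring G
  colouring = record
    { col = colF
    ; colSym = λ i j → cong₂ colN (ℕP.⊓-comm (toℕ i) (toℕ j)) (ℕP.⊔-comm (toℕ i) (toℕ j))
    }

  adjN-BA : ∀ {x y} → x < b → b ≤ y → adjN x y ≡ true
  adjN-BA {x} {y} x<b b≤y rewrite <⇒<ᵇ-true x<b | ≥⇒<ᵇ-false {y} b≤y = refl

  adjN-AB : ∀ {x y} → b ≤ x → y < b → adjN x y ≡ true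
  adjN-AB {x} {y} b≤x y<b rewrite ≥⇒<ᵇ-false {x} b≤x | <⇒<ᵇ-true y<b = refl

  adjN-BB : ∀ {x y} → x < b → y < b → adjN x y ≡ false
  adjN-BB {x} {y} x<b y<b rewrite <⇒<ᵇ-true x<b | <⇒<ᵇ-true y<b = refl

  adjN-AA : ∀ {x y} → b ≤ x → b ≤ y → adjN x y ≡ adjA (x ∸ b) (y ∸ b)
  adjN-AA {x} {y} b≤x b≤y rewrite ≥⇒<ᵇ-false {x} b≤x | ≥⇒<ᵇ-false {y} b≤y = refl

  colN-BA : ∀ {x y} → x < b → b ≤ y → colN x y ≡ K + (y + x * n)
  colN-BA {x} {y} x<b b≤y rewrite <⇒<ᵇ-true x<b | ≥⇒<ᵇ-false {y} b≤y = refl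

  colN-AA : ∀ {x y} → b ≤ x → b ≤ y → colN x y ≡ (x ∸ b) / L
  colN-AA {x} {y} b≤x b≤y rewrite ≥⇒<ᵇ-false {x} b≤x | ≥⇒<ᵇ-false {y} b≤y = refl

  2b≤n∸s : b * 2 ≤ n ∸ s
  2b≤n∸s = ℕP.≤-trans (ℕP.m≤n+m (b * 2) ((n ∸ s) % 2)) (ℕP.≤-reflexive (sym n∸s≡))

  n∸s≤2b+1 : n ∸ s ≤ suc (b * 2)
  n∸s≤2b+1 = ℕP.≤-trans (ℕP.≤-reflexive n∸s≡) (ℕP.+-monoˡ-≤ (b * 2) (ℕP.≤-pred (m%n<n (n ∸ s) 2)))

  b≤n : b ≤ n
  b≤n = ℕP.≤-trans (ℕP.m≤m*n b 2) (ℕP.≤-trans 2b≤n∸s (ℕP.m∸n≤m n s))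

  b+a≡n : b + a ≡ n
  b+a≡n = ℕP.m+[n∸m]≡n b≤n

  s≤n : s ≤ n
  s≤n = ℕP.≤-trans (s≤s (s≤s (ℕP.*-monoʳ-≤ 4 (ℕP.n≤1+n D)))) (ℕP.≤-trans (ℕP.≤-reflexive (ℕP.+-comm 2 (4 * r))) n-large)

  n≡[n∸s]+s : n ≡ (n ∸ s) + s
  n≡[n∸s]+s = sym (ℕP.m∸n+n≡m s≤n)

  b≤a : b ≤ a
  b≤a = ℕP.+-cancelˡ-≤ b b a (begin
      b + b
    ≡⟨ double b ⟩
      b * 2
    ≤⟨ ℕP.≤-trans 2b≤n∸s (ℕP.m∸n≤m n s) ⟩
      n
    ≡⟨ sym b+a≡n ⟩
      b + a ∎)
    where
    open ℕP.≤-Reasoning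
    double : ∀ x → x + x ≡ x * 2
    double = solve-∀

  n≤2a : n ≤ 2 * a
  n≤2a = begin
      n
    ≡⟨ sym b+a≡n ⟩
      b + a
    ≤⟨ ℕP.+-monoˡ-≤ a b≤a ⟩
      a + a
    ≡⟨ double a ⟩
      2 * a ∎
    where
    open ℕP.≤-Reasoning
    double : ∀ x → x + x ≡ 2 * x
    double = solve-∀

  w<a : suc w ≤ a
  w<a = ℕP.*-cancelˡ-≤ 2 (ℕP.≤-trans (ℕP.≤-reflexive (sym (4r+2≡2[w+1] D))) (ℕP.≤-trans n-large n≤2a))
    where
    4r+2≡2[w+1] : ∀ d → 4 * suc d + 2 ≡ 2 * suc (2 * suc d)
    4r+2≡2[w+1] = solve-∀

  n≤2[b+w] : n ≤ 2 * (b + w)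
  n≤2[b+w] = begin
      n
    ≡⟨ n≡[n∸s]+s ⟩
      (n ∸ s) + s
    ≤⟨ ℕP.+-monoˡ-≤ s n∸s≤2b+1 ⟩
      suc (b * 2) + s
    ≤⟨ ℕP.n≤1+n _ ⟩
      suc (suc (b * 2) + s)
    ≡⟨ rearrange D b ⟩
      2 * (b + w) ∎
    where
    open ℕP.≤-Reasoning
    rearrange : ∀ d x → suc (suc (x * 2) + suc (suc (4 * d))) ≡ 2 * (x + 2 * suc d)
    rearrange = solve-∀

  2b+K<n : 2 * b + K < n
  2b+K<n = begin-strict
      2 * b + K
    ≡⟨ cong (_+ K) (ℕP.*-comm 2 b) ⟩
      b * 2 + K
    ≤⟨ ℕP.+-monoˡ-≤ K 2b≤n∸s ⟩
      (n ∸ s) + K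
    <⟨ ℕP.+-monoʳ-< (n ∸ s) (ℕP.n<1+n K) ⟩
      (n ∸ s) + s
    ≡⟨ sym n≡[n∸s]+s ⟩
      n ∎
    where open ℕP.≤-Reasoning

  2a≤n+s+1 : 2 * a ≤ n + suc s
  2a≤n+s+1 = ℕP.+-cancelˡ-≤ n (2 * a) (n + suc s) (begin
      n + 2 * a
    ≤⟨ ℕP.+-monoˡ-≤ (2 * a) (ℕP.≤-trans (ℕP.≤-reflexive n≡[n∸s]+s) (ℕP.+-monoˡ-≤ s n∸s≤2b+1)) ⟩
      suc (b * 2) + s + 2 * a
    ≡⟨ regroup b a s ⟩
      (b + a) + ((b + a) + suc s)
    ≡⟨ cong₂ (λ u v → u + (v + suc s)) b+a≡n b+a≡n ⟩
      n + (n + suc s) ∎)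
    where
    open ℕP.≤-Reasoning
    regroup : ∀ x y z → suc (x * 2) + z + 2 * y ≡ (x + y) + ((x + y) + suc z)
    regroup = solve-∀

  a<K*L : a < K * L
  a<K*L = ℕP.<-≤-trans (proj₂ (division-block a K)) (ℕP.≤-reflexive (blocks (a / K) K))
    where
    blocks : ∀ q k → q * k + k ≡ k * suc q
    blocks = solve-∀

  K*L≤K+a : K * L ≤ K + a
  K*L≤K+a = ℕP.≤-trans (ℕP.≤-reflexive (blocks (a / K) K)) (ℕP.+-monoʳ-≤ K (proj₁ (division-block a K)))
    where
    blocks : ∀ q k → k * suc q ≡ k + q * k
    blocks = solve-∀

  -- The Dirac property: a vertex of B sees all of A, a vertex of A sees all of B
  -- and the other vertices of its window.

  window⊆A : ∀ p → lo p + suc w ≤ a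
  window⊆A p = ℕP.≤-trans (ℕP.+-monoˡ-≤ (suc w) (ℕP.m⊓n≤n (p ∸ r) (a ∸ suc w))) (ℕP.≤-reflexive (ℕP.m∸n+n≡m w<a))

  window-adjacent : ∀ {p q} → p ≢ q → lo p ≤ q → q ≤ lo p + w → adjA p q ≡ true
  window-adjacent p≢q lo≤q q≤hi =
    ∧-true (false⇒not-true (≢⇒≡ᵇ-false p≢q)) (∨-true-l (∧-true (false⇒not-true (≥⇒<ᵇ-false lo≤q)) (<⇒<ᵇ-true (s≤s q≤hi))))

  degree-B : ∀ v → toℕ v < b → a ≤ degree G v
  degree-B v v<b = count-interval-lower _ b a (ℕP.≤-reflexive b+a≡n) λ j b≤j _ → adjN-BA v<b b≤j

  degree-A : ∀ v → b ≤ toℕ v → b + w ≤ degree G v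
  degree-A v b≤x = begin
      b + w
    ≤⟨ ℕP.+-mono-≤ |InB| |NbrA| ⟩
      countFin InB + countFin NbrA
    ≤⟨ count-disjoint-∨ InB NbrA disjoint ⟩
      countFin (λ j → InB j ∨ NbrA j)
    ≤⟨ count-mono _ _ neighbour ⟩
      degree G v ∎
    where
    open ℕP.≤-Reasoning
    x p : ℕ
    x = toℕ v
    p = x ∸ b
    InB NbrA Self : Fin n → Bool
    InB j = toℕ j <ᵇ b
    NbrA j = adjN x (toℕ j) ∧ not (toℕ j <ᵇ b)
    Self j = toℕ j ≡ᵇ x

    disjoint : ∀ j → InB j ≡ true → NbrA j ≡ false
    disjoint j j∈B = trans (cong (λ t → adjN x (toℕ j) ∧ not t) j∈B) (∧-zeroʳ (adjN x (toℕ j)))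

    neighbour : ∀ j → (InB j ∨ NbrA j) ≡ true → adjN x (toℕ j) ≡ true
    neighbour j h with ∨-true-elim {InB j} h
    ... | inj₁ j∈B = adjN-AB b≤x (<ᵇ-true⇒< j∈B)
    ... | inj₂ nbr = ∧-true-l nbr

    |InB| : b ≤ countFin InB
    |InB| = count-interval-lower InB 0 b b≤n λ j _ j<b → <⇒<ᵇ-true j<b

    window-covered : ∀ j → b + lo p ≤ toℕ j → toℕ j < b + lo p + suc w → (NbrA j ∨ Self j) ≡ true
    window-covered j lo≤j j<hi with toℕ j ℕ.≟ x
    ... | yes j≡x = ∨-true-r {NbrA j} (≡⇒≡ᵇ-true j≡x)
    ... | no j≢x = ∨-true-l (∧-true (trans (adjN-AA b≤x b≤j) (window-adjacent p≢q lo≤q q≤hi)) (false⇒not-true (≥⇒<ᵇ-false b≤j)))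
      where
      b≤j : b ≤ toℕ j
      b≤j = ℕP.≤-trans (ℕP.m≤m+n b (lo p)) lo≤j
      lo≤q : lo p ≤ toℕ j ∸ b
      lo≤q = ℕP.m+n≤o⇒m≤o∸n (lo p) (ℕP.≤-trans (ℕP.≤-reflexive (ℕP.+-comm (lo p) b)) lo≤j)
      q≤hi : toℕ j ∸ b ≤ lo p + w
      q≤hi = ℕP.m≤n+o⇒m∸n≤o (toℕ j) b (ℕP.≤-pred (ℕP.≤-trans j<hi (ℕP.≤-reflexive (trans (ℕP.+-suc (b + lo p) w) (cong suc (ℕP.+-assoc b (lo p) w))))))
      p≢q : p ≢ toℕ j ∸ b
      p≢q p≡q = j≢x (ℕP.∸-cancelʳ-≡ b≤j b≤x (sym p≡q))

    |NbrA| : w ≤ countFin NbrA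
    |NbrA| = ℕP.≤-pred (begin
        suc w
      ≤⟨ count-interval-lower _ (b + lo p) (suc w) window-fits window-covered ⟩
        countFin (λ j → NbrA j ∨ Self j)
      ≤⟨ count-∨ NbrA Self ⟩
        countFin NbrA + countFin Self
      ≤⟨ ℕP.+-monoʳ-≤ (countFin NbrA) (count-unique Self λ i j hi hj → FP.toℕ-injective (trans (≡ᵇ-true⇒≡ hi) (sym (≡ᵇ-true⇒≡ hj)))) ⟩
        countFin NbrA + 1
      ≡⟨ ℕP.+-comm _ 1 ⟩
        suc (countFin NbrA) ∎)
      where
      window-fits : b + lo p + suc w ≤ n
      window-fits = ℕP.≤-trans (ℕP.≤-reflexive (ℕP.+-assoc b (lo p) (suc w))) (ℕP.≤-trans (ℕP.+-monoʳ-≤ b (window⊆A p)) (ℕP.≤-reflexive b+a≡n))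

  dirac : IsDirac G
  dirac v with toℕ v ℕ.<? b
  ... | yes v<b = ℕP.≤-trans n≤2a (ℕP.*-monoʳ-≤ 2 (degree-B v v<b))
  ... | no v≮b = ℕP.≤-trans n≤2[b+w] (ℕP.*-monoʳ-≤ 2 (degree-A v (ℕP.≮⇒≥ v≮b)))

  -- Colour classes.  Decoding the colours of cross edges divides by n ≠ 0.

  instance
    n-nonZero : NonZero n
    n-nonZero = ℕ.>-nonZero (ℕP.<-≤-trans (s≤s z≤n) n-large)

  inner-colour<K : ∀ {x} → b ≤ x → x < n → (x ∸ b) / L < K
  inner-colour<K b≤x x<n = m<n*o⇒m/o<n (ℕP.<-trans (ℕP.∸-monoˡ-< x<n b≤x) a<K*L)

  -- j is a forward neighbour of i along an edge of colour c; colourClassSize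
  -- counts exactly these pairs
  ForwardEdge : ℕ → Fin n → Fin n → Bool
  ForwardEdge c i j = (toℕ i <ᵇ toℕ j) ∧ (adjN (toℕ i) (toℕ j) ∧ (colF i j ≡ᵇ c))

  record Forward (c x y : ℕ) : Set where
    field
      x<y : x < y
      adjacent : adjN x y ≡ true
      coloured : colN x y ≡ c
  open Forward

  forward : ∀ {c} i j → ForwardEdge c i j ≡ true → Forward c (toℕ i) (toℕ j)
  forward {c} i j h = record
    { x<y = i<j
    ; adjacent = ∧-true-l rest
    ; coloured = trans (sym ordered) (≡ᵇ-true⇒≡ (∧-true-r {adjN (toℕ i) (toℕ j)} rest))
    }
    where
    i<j : toℕ i < toℕ j
    i<j = <ᵇ-true⇒< (∧-true-l h)
    rest : (adjN (toℕ i) (toℕ j) ∧ (colF i j ≡ᵇ c)) ≡ true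
    rest = ∧-true-r {toℕ i <ᵇ toℕ j} h
    ordered : colF i j ≡ colN (toℕ i) (toℕ j)
    ordered = cong₂ colN (ℕP.m≤n⇒m⊓n≡m (ℕP.<⇒≤ i<j)) (ℕP.m≤n⇒m⊔n≡n (ℕP.<⇒≤ i<j))

  data Side (x y : ℕ) : Set where
    cross : x < b → b ≤ y → Side x y
    inner : b ≤ x → b ≤ y → adjA (x ∸ b) (y ∸ b) ≡ true → Side x y

  side : ∀ {x y} → x < y → adjN x y ≡ true → Side x y
  side {x} {y} x<y adj with x ℕ.<? b | y ℕ.<? b
  ... | yes x<b | yes y<b = ⊥-elim (true≢false (trans (sym adj) (adjN-BB x<b y<b)))
  ... | yes x<b | no y≮b = cross x<b (ℕP.≮⇒≥ y≮b)
  ... | no x≮b | yes y<b = ⊥-elim (ℕP.<-irrefl refl (ℕP.<-trans y<b (ℕP.≤-<-trans (ℕP.≮⇒≥ x≮b) x<y)))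
  ... | no x≮b | no y≮b = inner (ℕP.≮⇒≥ x≮b) (ℕP.≮⇒≥ y≮b) (trans (sym (adjN-AA (ℕP.≮⇒≥ x≮b) (ℕP.≮⇒≥ y≮b))) adj)

  cross-edge-determined : ∀ {c x y} → K ≤ c → y < n → Forward c x y → (x ≡ (c ∸ K) / n) × (y + x * n ≡ c ∸ K)
  cross-edge-determined {c} {x} {y} K≤c y<n f with side (x<y f) (adjacent f)
  ... | inner b≤x b≤y _ =
    ⊥-elim (ℕP.<⇒≱ (inner-colour<K b≤x (ℕP.<-trans (x<y f) y<n)) (ℕP.≤-trans K≤c (ℕP.≤-reflexive (trans (sym (coloured f)) (colN-AA b≤x b≤y)))))
  ... | cross x<b b≤y = sym decode , code
    where
    code : y + x * n ≡ c ∸ K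
    code = trans (sym (ℕP.m+n∸m≡n K _)) (cong (_∸ K) (trans (sym (colN-BA x<b b≤y)) (coloured f)))
    decode : (c ∸ K) / n ≡ x
    decode = begin
        (c ∸ K) / n
      ≡⟨ cong (_/ n) (sym code) ⟩
        (y + x * n) / n
      ≡⟨ +-distrib-/-∣ʳ y (divides x refl) ⟩
        y / n + x * n / n
      ≡⟨ cong₂ _+_ (m<n⇒m/n≡0 y<n) (m*n/n≡m x n) ⟩
        x ∎
      where open ≡-Reasoning

  big-row : ∀ {c} → K ≤ c → ∀ i → countFin (ForwardEdge c i) ≤ indicator (toℕ i ≡ᵇ (c ∸ K) / n)
  big-row {c} K≤c i with true-or-false (toℕ i ≡ᵇ (c ∸ K) / n)
  ... | inj₁ source rewrite source = count-unique _ λ j j′ h h′ →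
    FP.toℕ-injective (ℕP.+-cancelʳ-≡ (toℕ i * n) (toℕ j) (toℕ j′)
      (trans (proj₂ (cross-edge-determined K≤c (FP.toℕ<n j) (forward i j h)))
             (sym (proj₂ (cross-edge-determined K≤c (FP.toℕ<n j′) (forward i j′ h′))))))
  ... | inj₂ other rewrite other = ℕP.≤-reflexive (count-none _ λ j → ¬true⇒false λ h →
    ≡ᵇ-false⇒≢ other (proj₁ (cross-edge-determined K≤c (FP.toℕ<n j) (forward i j h))))

  big-class : ∀ c → K ≤ c → colourClassSize colouring c ≤ 1
  big-class c K≤c = begin
      colourClassSize colouring c
    ≤⟨ sum-mono _ _ (big-row K≤c) ⟩
      sumFin (λ i → indicator (Source i))
    ≡⟨ sum-indicator Source ⟩
      countFin Source
    ≤⟨ count-unique Source (λ i j hi hj → FP.toℕ-injective (trans (≡ᵇ-true⇒≡ hi) (sym (≡ᵇ-true⇒≡ hj)))) ⟩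
      1 ∎
    where
    open ℕP.≤-Reasoning
    Source : Fin n → Bool
    Source i = toℕ i ≡ᵇ (c ∸ K) / n

  small-colour-inner : ∀ {c x y} → c < K → Forward c x y →
    (b ≤ x) × (b ≤ y) × (adjA (x ∸ b) (y ∸ b) ≡ true) × ((x ∸ b) / L ≡ c)
  small-colour-inner c<K f with side (x<y f) (adjacent f)
  ... | cross x<b b≤y = ⊥-elim (ℕP.<⇒≱ c<K (ℕP.≤-trans (ℕP.m≤m+n K _) (ℕP.≤-reflexive (trans (sym (colN-BA x<b b≤y)) (coloured f)))))
  ... | inner b≤x b≤y adj = b≤x , b≤y , adj , trans (sym (colN-AA b≤x b≤y)) (coloured f)

  forward-reach : ∀ p q → adjA p q ≡ true → q < a → (q ≤ p + w) × (r ≤ p → suc (p + w) < a → q ≤ p + r)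
  forward-reach p q adj q<a with ∨-true-elim (∧-true-r {not (p ≡ᵇ q)} adj)
  ... | inj₁ q∈win = ℕP.≤-trans q≤ (ℕP.+-monoˡ-≤ w (ℕP.m∸n≤m p r)) , λ r≤p _ → ℕP.≤-trans q≤ (ℕP.≤-reflexive (regroup r≤p))
    where
    q≤ : q ≤ (p ∸ r) + w
    q≤ = ℕP.≤-trans (ℕP.≤-pred (<ᵇ-true⇒< (∧-true-r {not (q <ᵇ lo p)} q∈win))) (ℕP.+-monoˡ-≤ w (ℕP.m⊓n≤m (p ∸ r) (a ∸ suc w)))
    t+2u : ∀ t u → t + 2 * u ≡ (t + u) + u
    t+2u = solve-∀
    regroup : r ≤ p → (p ∸ r) + w ≡ p + r
    regroup r≤p = trans (t+2u (p ∸ r) r) (cong (_+ r) (ℕP.m∸n+n≡m r≤p))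
  ... | inj₂ p∈win with ⊓≤-cases (q ∸ r) (a ∸ suc w) p (<ᵇ-false⇒≥ (not-true⇒false (∧-true-l p∈win)))
  ...   | inj₁ q∸r≤p = ℕP.≤-trans q≤p+r (ℕP.+-monoʳ-≤ p (ℕP.m≤m+n r (r + 0))) , λ _ _ → q≤p+r
    where
    q≤p+r : q ≤ p + r
    q≤p+r = ℕP.≤-trans (ℕP.m≤n+m∸n q r) (ℕP.≤-trans (ℕP.+-monoʳ-≤ r q∸r≤p) (ℕP.≤-reflexive (ℕP.+-comm r p)))
  ...   | inj₂ end≤p = ℕP.≤-pred (ℕP.<-≤-trans q<a a≤p+w+1) , λ _ p+w+1<a → ⊥-elim (ℕP.<-irrefl refl (ℕP.<-≤-trans p+w+1<a a≤p+w+1))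
    where
    a≤p+w+1 : a ≤ suc (p + w)
    a≤p+w+1 = ℕP.≤-trans (ℕP.m≤n+m∸n a (suc w)) (ℕP.≤-trans (ℕP.+-monoʳ-≤ (suc w) end≤p) (ℕP.≤-reflexive (cong suc (ℕP.+-comm w p))))

  forward-bound : ∀ {c x y} → c < K → y < n → Forward c x y →
    (y ≤ x + w) × (r ≤ x ∸ b → suc ((x ∸ b) + w) < a → y ≤ x + r)
  forward-bound {c} {x} {y} c<K y<n f with small-colour-inner c<K f
  ... | b≤x , b≤y , adj , _ = shift-≤ w b≤x (proj₁ reach) , λ h₁ h₂ → shift-≤ r b≤x (proj₂ reach h₁ h₂)
    where
    reach : (y ∸ b ≤ (x ∸ b) + w) × (r ≤ x ∸ b → suc ((x ∸ b) + w) < a → y ∸ b ≤ (x ∸ b) + r)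
    reach = forward-reach _ _ adj (ℕP.∸-monoˡ-< y<n b≤y)

  -- block c of A, and the exceptional vertices: the first r and the last w + 1 of A
  InBlock : ℕ → ℕ → Bool
  InBlock c x = not (x <ᵇ b) ∧ ((x ∸ b) / L ≡ᵇ c)

  Exceptional : ℕ → Bool
  Exceptional x = (not (x <ᵇ b) ∧ (x <ᵇ b + r)) ∨ (n <ᵇ x + suc (suc w))

  regular-position : ∀ {x} → b ≤ x → Exceptional x ≡ false → (r ≤ x ∸ b) × (suc ((x ∸ b) + w) < a)
  regular-position {x} b≤x regular = r≤p , p+w+1<a
    where
    not-early : (not (x <ᵇ b) ∧ (x <ᵇ b + r)) ≡ false
    not-early = proj₁ (∨-false {not (x <ᵇ b) ∧ (x <ᵇ b + r)} regular)
    not-late : (n <ᵇ x + suc (suc w)) ≡ false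
    not-late = proj₂ (∨-false {not (x <ᵇ b) ∧ (x <ᵇ b + r)} regular)
    b+r≤x : b + r ≤ x
    b+r≤x = <ᵇ-false⇒≥ (trans (sym (cong (_∧ (x <ᵇ b + r)) (false⇒not-true (≥⇒<ᵇ-false b≤x)))) not-early)
    r≤p : r ≤ x ∸ b
    r≤p = ℕP.m+n≤o⇒m≤o∸n r (ℕP.≤-trans (ℕP.≤-reflexive (ℕP.+-comm r b)) b+r≤x)
    p+w+1<a : suc ((x ∸ b) + w) < a
    p+w+1<a = ℕP.≤-trans (ℕP.≤-reflexive shifted) (ℕP.∸-monoˡ-≤ b (<ᵇ-false⇒≥ not-late))
      where
      shifted : suc (suc ((x ∸ b) + w)) ≡ (x + suc (suc w)) ∸ b
      shifted = sym (trans (ℕP.+-∸-comm (suc (suc w)) b≤x) (trans (ℕP.+-suc _ (suc w)) (cong suc (ℕP.+-suc _ w))))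

  source-in-block : ∀ {c} → c < K → ∀ i j → ForwardEdge c i j ≡ true → InBlock c (toℕ i) ≡ true
  source-in-block c<K i j h with small-colour-inner c<K (forward i j h)
  ... | b≤x , _ , _ , block = ∧-true (false⇒not-true (≥⇒<ᵇ-false b≤x)) (≡⇒≡ᵇ-true block)

  forward-within : ∀ {c} i k → (∀ j → ForwardEdge c i j ≡ true → toℕ j ≤ toℕ i + k) → countFin (ForwardEdge c i) ≤ k
  forward-within i k h = count-interval-upper _ (suc (toℕ i)) k λ j e → x<y (forward i j e) , s≤s (h j e)

  small-row : ∀ {c} → c < K → ∀ i →
    countFin (ForwardEdge c i) ≤ r * indicator (InBlock c (toℕ i)) + r * indicator (Exceptional (toℕ i))
  small-row {c} c<K i with true-or-false (InBlock c (toℕ i)) | true-or-false (Exceptional (toℕ i))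
  ... | inj₂ outside | _ = ℕP.≤-trans (ℕP.≤-reflexive (count-none _ λ j → ¬true⇒false λ h →
    true≢false (trans (sym (source-in-block c<K i j h)) outside))) z≤n
  ... | inj₁ inside | inj₁ exceptional rewrite inside | exceptional =
    ℕP.≤-trans (forward-within i w λ j h → proj₁ (forward-bound c<K (FP.toℕ<n j) (forward i j h))) (ℕP.≤-reflexive (2r≡r+r r))
    where
    2r≡r+r : ∀ t → 2 * t ≡ t * 1 + t * 1
    2r≡r+r = solve-∀
  ... | inj₁ inside | inj₂ regular rewrite inside | regular =
    ℕP.≤-trans (forward-within i r λ j h → proj₂ (forward-bound c<K (FP.toℕ<n j) (forward i j h)) r≤p p+w+1<a) (ℕP.≤-reflexive (r≡r+0 r))
    where
    b≤x : b ≤ toℕ i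
    b≤x = <ᵇ-false⇒≥ (not-true⇒false (∧-true-l inside))
    r≤p : r ≤ toℕ i ∸ b
    r≤p = proj₁ (regular-position b≤x regular)
    p+w+1<a : suc ((toℕ i ∸ b) + w) < a
    p+w+1<a = proj₂ (regular-position b≤x regular)
    r≡r+0 : ∀ t → t ≡ t * 1 + t * 0
    r≡r+0 = solve-∀

  block-size : ∀ c → countFin {n} (λ i → InBlock c (toℕ i)) ≤ L
  block-size c = count-interval-upper {n} (λ i → InBlock c (toℕ i)) (b + c * L) L λ i h → in-interval (toℕ i) h
    where
    in-interval : ∀ x → InBlock c x ≡ true → (b + c * L ≤ x) × (x < b + c * L + L)
    in-interval x h = lower , upper
      where
      open ℕP.≤-Reasoning
      b≤x : b ≤ x
      b≤x = <ᵇ-false⇒≥ (not-true⇒false (∧-true-l h))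
      block : (x ∸ b) / L ≡ c
      block = ≡ᵇ-true⇒≡ (∧-true-r {not (x <ᵇ b)} h)
      bounds : ((x ∸ b) / L * L ≤ x ∸ b) × (x ∸ b < (x ∸ b) / L * L + L)
      bounds = division-block (x ∸ b) L
      lower : b + c * L ≤ x
      lower = ℕP.≤-trans (ℕP.+-monoʳ-≤ b (subst (λ t → t * L ≤ x ∸ b) block (proj₁ bounds))) (ℕP.≤-reflexive (ℕP.m+[n∸m]≡n b≤x))
      upper : x < b + c * L + L
      upper = begin-strict
          x
        ≡⟨ sym (ℕP.m+[n∸m]≡n b≤x) ⟩
          b + (x ∸ b)
        <⟨ ℕP.+-monoʳ-< b (subst (λ t → x ∸ b < t * L + L) block (proj₂ bounds)) ⟩
          b + (c * L + L)
        ≡⟨ sym (ℕP.+-assoc b (c * L) L) ⟩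
          b + c * L + L ∎

  exceptional-count : countFin {n} (λ i → Exceptional (toℕ i)) ≤ E
  exceptional-count = ℕP.≤-trans (count-∨ Early Late) (ℕP.+-mono-≤ |Early| |Late|)
    where
    Early Late : Fin n → Bool
    Early i = not (toℕ i <ᵇ b) ∧ (toℕ i <ᵇ b + r)
    Late i = n <ᵇ toℕ i + suc (suc w)
    |Early| : countFin Early ≤ r
    |Early| = count-interval-upper Early b r λ i h →
      <ᵇ-false⇒≥ (not-true⇒false (∧-true-l h)) , <ᵇ-true⇒< (∧-true-r {not (toℕ i <ᵇ b)} h)
    w+1≤n : suc w ≤ n
    w+1≤n = ℕP.≤-trans w<a (ℕP.m∸n≤m n b)
    late-start : ∀ i → Late i ≡ true → n ∸ suc w ≤ toℕ i
    late-start i h = ℕP.m≤n+o⇒m∸n≤o n (suc w) (ℕP.≤-trans (ℕP.≤-pred (ℕP.≤-trans (<ᵇ-true⇒< h)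
      (ℕP.≤-reflexive (ℕP.+-suc (toℕ i) (suc w))))) (ℕP.≤-reflexive (ℕP.+-comm (toℕ i) (suc w))))
    |Late| : countFin Late ≤ suc w
    |Late| = count-interval-upper Late (n ∸ suc w) (suc w) λ i h →
      late-start i h , ℕP.<-≤-trans (FP.toℕ<n i) (ℕP.≤-reflexive (sym (ℕP.m∸n+n≡m w+1≤n)))

  small-class : ∀ c → c < K → colourClassSize colouring c ≤ r * (L + E)
  small-class c c<K = begin
      colourClassSize colouring c
    ≤⟨ sum-mono _ _ (small-row c<K) ⟩
      sumFin (λ i → r * indicator (Block i) + r * indicator (Exc i))
    ≡⟨ sum-+ (λ i → r * indicator (Block i)) (λ i → r * indicator (Exc i)) ⟩
      sumFin (λ i → r * indicator (Block i)) + sumFin (λ i → r * indicator (Exc i))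
    ≡⟨ cong₂ _+_ (sum-scaled-indicator r Block) (sum-scaled-indicator r Exc) ⟩
      r * countFin Block + r * countFin Exc
    ≤⟨ ℕP.+-mono-≤ (ℕP.*-monoʳ-≤ r (block-size c)) (ℕP.*-monoʳ-≤ r exceptional-count) ⟩
      r * L + r * E
    ≡⟨ sym (ℕP.*-distribˡ-+ r L E) ⟩
      r * (L + E) ∎
    where
    open ℕP.≤-Reasoning
    Block Exc : Fin n → Bool
    Block i = InBlock c (toℕ i)
    Exc i = Exceptional (toℕ i)

  class-bound : ∀ c → colourClassSize colouring c ≤ r * (L + E)
  class-bound c with c ℕ.<? K
  ... | yes c<K = small-class c c<K
  ... | no c≮K = ℕP.≤-trans (big-class c (ℕP.≮⇒≥ c≮K)) (ℕP.≤-trans (s≤s z≤n) (ℕP.m≤m*n r (L + E)))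

  blocks-small : threshold ≤ n → 8 * D * (L + E) ≤ n
  blocks-small large = ℕP.*-cancelˡ-≤ K (begin
      K * (8 * D * (L + E))
    ≡⟨ expand D K L E ⟩
      8 * D * (K * L) + 8 * D * K * E
    ≤⟨ ℕP.+-monoˡ-≤ (8 * D * K * E) (ℕP.*-monoʳ-≤ (8 * D) K*L≤K+a) ⟩
      8 * D * (K + a) + 8 * D * K * E
    ≡⟨ regroup D K a E ⟩
      4 * D * (2 * a) + (8 * D * K + 8 * D * K * E)
    ≤⟨ ℕP.+-monoˡ-≤ (8 * D * K + 8 * D * K * E) (ℕP.*-monoʳ-≤ (4 * D) 2a≤n+s+1) ⟩
      4 * D * (n + suc s) + (8 * D * K + 8 * D * K * E)
    ≡⟨ collect D K n (suc s) E ⟩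
      4 * D * n + threshold
    ≤⟨ ℕP.+-monoʳ-≤ (4 * D * n) large ⟩
      4 * D * n + n
    ≡⟨ ℕP.+-comm (4 * D * n) n ⟩
      K * n ∎)
    where
    open ℕP.≤-Reasoning
    expand : ∀ d k l e → k * (8 * d * (l + e)) ≡ 8 * d * (k * l) + 8 * d * k * e
    expand = solve-∀
    regroup : ∀ d k x e → 8 * d * (k + x) + 8 * d * k * e ≡ 4 * d * (2 * x) + (8 * d * k + 8 * d * k * e)
    regroup = solve-∀
    collect : ∀ d k m t e → 4 * d * (m + t) + (8 * d * k + 8 * d * k * e) ≡ 4 * d * m + (4 * d * t + 8 * d * k * (1 + e))
    collect = solve-∀

  class-bound-ratio : ∀ N → r ≤ N * 8 → threshold ≤ n → ∀ c → D * colourClassSize colouring c ≤ N * n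
  class-bound-ratio N r≤8N large c = ℕP.*-cancelˡ-≤ 8 (begin
      8 * (D * colourClassSize colouring c)
    ≤⟨ ℕP.*-monoʳ-≤ 8 (ℕP.*-monoʳ-≤ D (class-bound c)) ⟩
      8 * (D * (r * (L + E)))
    ≡⟨ swap D r (L + E) ⟩
      r * (8 * D * (L + E))
    ≤⟨ ℕP.*-mono-≤ r≤8N (blocks-small large) ⟩
      N * 8 * n
    ≡⟨ reorder N n ⟩
      8 * (N * n) ∎)
    where
    open ℕP.≤-Reasoning
    swap : ∀ d t m → 8 * (d * (t * m)) ≡ t * (8 * d * m)
    swap = solve-∀
    reorder : ∀ x y → x * 8 * y ≡ 8 * (x * y)
    reorder = solve-∀

  -- no Hamilton cycle is rainbow: the edges avoiding B use the K colours below K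
  no-rainbow : (H : HamiltonCycle G) → ¬ Rainbow colouring H
  no-rainbow = few-colours⇒¬rainbow colouring InB b K |B| inner<K 2b+K<n
    where
    InB : Fin n → Bool
    InB j = toℕ j <ᵇ b
    |B| : countFin InB ≤ b
    |B| = count-interval-upper InB 0 b λ j h → z≤n , <ᵇ-true⇒< h
    inner<K : ∀ i j → InB i ≡ false → InB j ≡ false → adj G i j ≡ true → colF i j < K
    inner<K i j i∉B j∉B _ = subst (_< K) (sym (colN-AA b≤min b≤max))
      (inner-colour<K b≤min (ℕP.≤-<-trans (ℕP.m⊓n≤m (toℕ i) (toℕ j)) (FP.toℕ<n i)))
      where
      b≤min : b ≤ toℕ i ⊓ toℕ j
      b≤min = ℕP.⊓-glb (<ᵇ-false⇒≥ i∉B) (<ᵇ-false⇒≥ j∉B)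
      b≤max : b ≤ toℕ i ⊔ toℕ j
      b≤max = ℕP.≤-trans (<ᵇ-false⇒≥ i∉B) (ℕP.m≤m⊔n (toℕ i) (toℕ j))

theorem4 : (μ : ℚ) → μ ℚ.> (ℤ.+ 1) ℚ./ 8 →
  ∃ λ (n₀ : ℕ) → ∀ (n : ℕ) → n ≥ n₀ →
    Σ (Graph n) λ G → IsDirac G ×
      Σ (EdgeColouring G) λ c → Bounded (μ ℚ.* ((ℤ.+ n) ℚ./ 1)) c ×
        ((H : HamiltonCycle G) → ¬ Rainbow c H)
theorem4 (mkℚ -[1+ N ] d cop) (*<* ())
theorem4 (mkℚ (ℤ.+ N) d cop) μ>1/8 = n₀ , λ n n≥n₀ →
  let open Construction D n (ℕP.≤-trans (ℕP.m≤n+m _ threshold) n≥n₀)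
      large : threshold ≤ n
      large = ℕP.≤-trans (ℕP.m≤m+n threshold _) n≥n₀
  in G , dirac , colouring ,
     (λ c → ≤-fraction-* N d cop _ n (class-bound-ratio N (>1/8⇒denominator<8·numerator N d cop μ>1/8) large c)) ,
     no-rainbow
  where
  D : ℕ
  D = suc d
  open Parameters D using (threshold)
  n₀ : ℕ
  n₀ = threshold + (4 * suc D + 2)
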